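{- Let $t\ge 1$ and let $S=\{k_1,\ldots,k_t\}$ with $k_1<\cdots<k_t$ be positive integers with $\gcd\{k_1,\ldots,k_t\}=1$. Define sequences $(a_n^{T})_{n\ge0}$ for nonempty $T\subseteq S$ of the form $T=\{k_1,\ldots,k_s\}$ recursively, as follows. For $s=1$, set $a_n^{\{k_1\}}=\frac{1+(-1)^{\lfloor n/k_1\rfloor+1}}{2}$. For $s\ge2$, set $$a_n^{\{k_1,\ldots,k_s\}}=\begin{cases}a_n^{\{k_1,\ldots,k_{s-1}\}}, & 0\le n<k_s,\\[1mm] 1-\dfrac1s\displaystyle\sum_{i=1}^s a^{\{k_1,\ldots,k_s\}}_{n-k_i}, & n\ge k_s.\end{cases}$$ If $k_i\equiv 0\pmod 2$ for some $i\in\{1,\ldots,t\}$, then $\lim_{n\to\infty}a_n^S=\frac12$.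
   Context: $a_n^S$ is the probability that the next player to move wins the randomized one-pile subtraction game with subtraction set $S$ starting from a pile of $n$ chips. In this game, at each position $m$ an element of $\{s\in S: s\le m\}$ is chosen uniformly at random and that many chips are removed. The player facing a position with no legal move loses. -}

module Defs where

open import Data.Nat as ℕ using (ℕ; zero; suc; _∸_; _<ᵇ_)
open import Data.Nat.DivMod using (_/_)
open import Data.Nat.GCD using (gcd)
open import Data.Integer using (+_)
open import Data.Rational as ℚ using (ℚ; 0ℚ; 1ℚ; _+_; _-_; _*_; -_)
open import Data.List using (List; []; _∷_; length; reverse; foldr; map; sum)
open import Data.Bool using (if_then_else_)

-- floor division n / k (only used for k ≥ 1; value for k = 0 irrelevant)
divN : ℕ → ℕ → ℕ
divN n zero = 0
divN n (suc k) = n / suc k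

negOnePow : ℕ → ℚ
negOnePow zero = 1ℚ
negOnePow (suc m) = - negOnePow m

at : List ℚ → ℕ → ℚ
at [] _ = 0ℚ
at (x ∷ xs) zero = x
at (x ∷ xs) (suc i) = at xs i

sumℚ : List ℚ → ℚ
sumℚ = foldr _+_ 0ℚ

-- Sets T = {k₁ < … < k_s} are represented by the DECREASING list
-- k_s ∷ k_{s-1} ∷ … ∷ k₁ ∷ [] (so the tail is the prefix {k₁,…,k_{s-1}}).
-- hist T n = [a_{n-1}^T , … , a_0^T]  (most recent first), so that
-- a_{n-k}^T = at (hist T n) (k ∸ 1) for 1 ≤ k ≤ n.
mutual
  hist : List ℕ → ℕ → List ℚ
  hist T zero = []
  hist T (suc n) = value T n (hist T n) ∷ hist T n

  value : List ℕ → ℕ → List ℚ → ℚ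
  value [] n h = 0ℚ
  value (k ∷ []) n h =
    (1ℚ + negOnePow (suc (divN n k))) * ℚ.½
  value (k ∷ rest@(_ ∷ _)) n h =
    if n <ᵇ k
    then value rest n (hist rest n)
    else 1ℚ - ((+ 1 ℚ./ suc (length rest)) * sumℚ (map (λ kᵢ → at h (kᵢ ∸ 1)) (k ∷ rest)))

-- a_n^S for S given as the INCREASING list k₁ ∷ … ∷ k_t ∷ []
a : List ℕ → ℕ → ℚ
a S n = value (reverse S) n (hist (reverse S) n)

gcdList : List ℕ → ℕ
gcdList = foldr gcd 0

ConvergesTo : (ℕ → ℚ) → ℚ → Set
ConvergesTo f L =
  ∀ (ε : ℚ) → 0ℚ ℚ.< ε → Data.Product.∃ λ N → ∀ n → N ℕ.≤ n → ℚ.∣ f n - L ∣ ℚ.< ε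
  where import Data.Product

{-# OPTIONS --safe #-}
-- With g n = a n - ½, the recurrence becomes the homogeneous relation Σ_{k ∈ S} g (n - k) = -|S| g n for
-- n ≥ max S, and |g| ≤ 1. Suppose |g| ≤ M on a tail and g n = M - e. Since the terms g (n - k) are ≥ -M and
-- sum to -|S| (M - e), each one is within |S| e of -M; repeating, g after q steps of size k back is within
-- |S|^q e of (-1)^q M. Going back k steps of an odd size k′ or k′ steps of an even size k reaches the same
-- index with opposite signs, which forces e ≥ M / C for a constant C. So the bound M improves to (1 - 1/C) M
-- on a later tail, and iterating, g n → 0.
module Submission where

open import Defs
open import Data.Nat using (ℕ; _<_; _≤_)
open import Data.Nat.Divisibility using (_∣_)
open import Data.List using (List; [])
open import Data.List.Relation.Unary.All using (All)
open import Data.List.Relation.Unary.Any using (Any)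
open import Data.List.Relation.Unary.Linked using (Linked)
open import Data.Rational using (½)
open import Relation.Binary.PropositionalEquality using (_≡_; _≢_)

open import Data.Nat as ℕ using (zero; suc; _∸_)
import Data.Nat.Properties as ℕₚ
import Data.Nat.Coprimality as Coprime
open import Data.Nat.Divisibility using (_∣?_; ∣1⇒≡1; ∣m+n∣m⇒∣n; ∣m∣n⇒∣m+n; ∣-refl; _∣0)
open import Data.Nat.GCD using (gcd-greatest)
open import Data.Integer as ℤ using (-[1+_])
import Data.Integer.Properties as ℤₚ
open import Data.Rational as ℚ using (ℚ; 0ℚ; 1ℚ; _+_; _-_; _*_; -_; 1/_; ∣_∣; mkℚ)
  renaming (_≤_ to _≤ℚ_; _<_ to _<ℚ_)
import Data.Rational.Properties as ℚₚ
open import Data.Rational.Solver using (module +-*-Solver)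
open +-*-Solver using (solve; _:=_; _:+_; _:*_; _:-_; :-_; con)
open import Algebra.Definitions.RawSemiring ℚ.+-*-rawSemiring using (_^_)
open import Algebra.Properties.Group ℚₚ.+-0-group using () renaming (⁻¹-involutive to neg-involutive)
open import Data.List using (_∷_; map; length; reverse)
open import Data.List.Extrema.Nat using (max; xs≤max)
open import Data.List.Membership.Propositional using (_∈_; find)
open import Data.List.Relation.Unary.All as All using ([]; _∷_)
open import Data.List.Relation.Unary.All.Properties.Core using (¬All⇒Any¬)
open import Data.List.Relation.Unary.Any using (here; there)
open import Data.List.Relation.Unary.Any.Properties using (reverse⁺; reverse⁻)
open import Data.Product using (_×_; _,_; proj₁; proj₂; ∃)
open import Data.Sum using (inj₁; inj₂)
open import Data.Bool using (true; false; T; if_then_else_)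
open import Data.Empty using (⊥-elim)
open import Relation.Nullary using (¬_; yes; no)
open import Relation.Binary.PropositionalEquality
  using (refl; sym; trans; cong; cong₂; subst; subst₂; module ≡-Reasoning)

p≤q⇒0≤q-p : ∀ {p q} → p ≤ℚ q → 0ℚ ≤ℚ q - p
p≤q⇒0≤q-p {p} {q} p≤q = subst (_≤ℚ q - p) (ℚₚ.+-inverseʳ p) (ℚₚ.+-monoˡ-≤ (- p) p≤q)

≤-byGap : ∀ {p q} d → 0ℚ ≤ℚ d → d ≡ q - p → p ≤ℚ q
≤-byGap {p} {q} d 0≤d d≡q-p = subst₂ _≤ℚ_ (ℚₚ.+-identityˡ p) q-p+p≡q
  (ℚₚ.+-monoˡ-≤ p (subst (0ℚ ≤ℚ_) d≡q-p 0≤d))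
  where
  q-p+p≡q : q - p + p ≡ q
  q-p+p≡q = solve 2 (λ p q → q :- p :+ p := q) refl p q

<-byGap : ∀ {p q} d → 0ℚ <ℚ d → d ≡ q - p → p <ℚ q
<-byGap {p} {q} d 0<d d≡q-p = subst₂ _<ℚ_ (ℚₚ.+-identityˡ p) q-p+p≡q
  (ℚₚ.+-monoˡ-< p (subst (0ℚ <ℚ_) d≡q-p 0<d))
  where
  q-p+p≡q : q - p + p ≡ q
  q-p+p≡q = solve 2 (λ p q → q :- p :+ p := q) refl p q

0≤1 : 0ℚ ≤ℚ 1ℚ
0≤1 = ℚₚ.nonNegative⁻¹ 1ℚ

nonNeg+nonNeg : ∀ {p q} → 0ℚ ≤ℚ p → 0ℚ ≤ℚ q → 0ℚ ≤ℚ p + q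
nonNeg+nonNeg = ℚₚ.+-mono-≤

nonNeg*nonNeg : ∀ {p q} → 0ℚ ≤ℚ p → 0ℚ ≤ℚ q → 0ℚ ≤ℚ p * q
nonNeg*nonNeg {p} {q} 0≤p 0≤q =
  subst (_≤ℚ p * q) (ℚₚ.*-zeroˡ q) (ℚₚ.*-monoʳ-≤-nonNeg q {{ℚ.nonNegative 0≤q}} 0≤p)

*-monoˡ-≤-0≤ : ∀ {r p q} → 0ℚ ≤ℚ r → p ≤ℚ q → r * p ≤ℚ r * q
*-monoˡ-≤-0≤ {r} 0≤r = ℚₚ.*-monoˡ-≤-nonNeg r {{ℚ.nonNegative 0≤r}}

-‿antimonoʳ-≤ : ∀ r {p q} → p ≤ℚ q → r - q ≤ℚ r - p
-‿antimonoʳ-≤ r p≤q = ℚₚ.+-monoʳ-≤ r (ℚₚ.neg-antimono-≤ p≤q)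

1≤*1≤⇒1≤ : ∀ {p q} → 1ℚ ≤ℚ p → 1ℚ ≤ℚ q → 1ℚ ≤ℚ p * q
1≤*1≤⇒1≤ {p} {q} 1≤p 1≤q = ≤-byGap ((p - 1ℚ) * (q - 1ℚ) + (p - 1ℚ) + (q - 1ℚ))
  (nonNeg+nonNeg (nonNeg+nonNeg (nonNeg*nonNeg 0≤p-1 0≤q-1) 0≤p-1) 0≤q-1)
  (solve 2 (λ p q → (p :- con 1ℚ) :* (q :- con 1ℚ) :+ (p :- con 1ℚ) :+ (q :- con 1ℚ) := p :* q :- con 1ℚ)
     refl p q)
  where
  0≤p-1 = p≤q⇒0≤q-p 1≤p
  0≤q-1 = p≤q⇒0≤q-p 1≤q

1≤⇒1≤^ : ∀ {p} → 1ℚ ≤ℚ p → ∀ r → 1ℚ ≤ℚ p ^ r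
1≤⇒1≤^ 1≤p zero = ℚₚ.≤-refl
1≤⇒1≤^ 1≤p (suc r) = 1≤*1≤⇒1≤ 1≤p (1≤⇒1≤^ 1≤p r)

0≤⇒0≤^ : ∀ {p} → 0ℚ ≤ℚ p → ∀ r → 0ℚ ≤ℚ p ^ r
0≤⇒0≤^ 0≤p zero = 0≤1
0≤⇒0≤^ 0≤p (suc r) = nonNeg*nonNeg 0≤p (0≤⇒0≤^ 0≤p r)

-q≤p≤q<r⇒∣p∣<r : ∀ {p q r} → - q ≤ℚ p → p ≤ℚ q → q <ℚ r → ∣ p ∣ <ℚ r
-q≤p≤q<r⇒∣p∣<r {p} {q} {r} -q≤p p≤q q<r with ℚₚ.∣p∣≡p∨∣p∣≡-p p
... | inj₁ ∣p∣≡p = subst (_<ℚ r) (sym ∣p∣≡p) (ℚₚ.≤-<-trans p≤q q<r)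
... | inj₂ ∣p∣≡-p = subst (_<ℚ r) (sym ∣p∣≡-p)
  (ℚₚ.≤-<-trans (subst (- p ≤ℚ_) (neg-involutive q) (ℚₚ.neg-antimono-≤ -q≤p)) q<r)

fromℕ : ℕ → ℚ
fromℕ zero = 0ℚ
fromℕ (suc n) = 1ℚ + fromℕ n

fromℕ-nonNeg : ∀ n → 0ℚ ≤ℚ fromℕ n
fromℕ-nonNeg zero = ℚₚ.≤-refl
fromℕ-nonNeg (suc n) = nonNeg+nonNeg 0≤1 (fromℕ-nonNeg n)

1≤fromℕ-suc : ∀ n → 1ℚ ≤ℚ fromℕ (suc n)
1≤fromℕ-suc n =
  ≤-byGap (fromℕ n) (fromℕ-nonNeg n) (solve 1 (λ x → x := con 1ℚ :+ x :- con 1ℚ) refl (fromℕ n))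

fromℕ≡mkℚ : ∀ n → fromℕ n ≡ mkℚ (ℤ.+ n) 0 (Coprime.sym (Coprime.1-coprimeTo n))
fromℕ≡mkℚ zero = refl
fromℕ≡mkℚ (suc n) rewrite fromℕ≡mkℚ n =
  trans (cong (λ z → z ℚ./ 1) (cong (ℤ._+_ (ℤ.+ 1)) (ℤₚ.*-identityʳ (ℤ.+ n))))
        (ℚₚ.↥p/↧p≡p (mkℚ (ℤ.+ suc n) 0 (Coprime.sym (Coprime.1-coprimeTo (suc n)))))

1/suc*fromℕ-suc : ∀ n → (ℤ.+ 1 ℚ./ suc n) * fromℕ (suc n) ≡ 1ℚ
1/suc*fromℕ-suc n rewrite fromℕ≡mkℚ (suc n) =
  trans (cong (_* p) (ℚₚ.↥p/↧p≡p (1/ p))) (ℚₚ.*-inverseˡ p)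
  where
  p = mkℚ (ℤ.+ suc n) 0 (Coprime.sym (Coprime.1-coprimeTo (suc n)))

0≤1/suc : ∀ n → 0ℚ ≤ℚ (ℤ.+ 1 ℚ./ suc n)
0≤1/suc n = ℚₚ.nonNegative⁻¹ _ {{ℚₚ.normalize-nonNeg 1 (suc n)}}

p≤fromℕ∣↥p∣ : ∀ p → p ≤ℚ fromℕ ℤ.∣ ℚ.↥ p ∣
p≤fromℕ∣↥p∣ (mkℚ (ℤ.+ n) d c) rewrite fromℕ≡mkℚ n =
  ℚ.*≤* (ℤₚ.*-monoˡ-≤-nonNeg (ℤ.+ n) (ℤ.+≤+ (ℕ.s≤s ℕ.z≤n)))
p≤fromℕ∣↥p∣ (mkℚ -[1+ n ] d c) = ℚₚ.≤-trans (ℚₚ.<⇒≤ (ℚₚ.negative⁻¹ _)) (fromℕ-nonNeg (suc n))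

archimedean : ∀ {y} → 0ℚ <ℚ y → ∃ λ r → 1ℚ ≤ℚ fromℕ r * y
archimedean {y} 0<y = r , subst (_≤ℚ fromℕ r * y) (ℚₚ.*-inverseˡ y)
  (ℚₚ.*-monoʳ-≤-nonNeg y {{ℚ.nonNegative (ℚₚ.<⇒≤ 0<y)}} (p≤fromℕ∣↥p∣ (1/ y)))
  where
  instance
    y≢0 : ℚ.NonZero y
    y≢0 = ℚₚ.pos⇒nonZero y {{ℚ.positive 0<y}}
  r : ℕ
  r = ℤ.∣ ℚ.↥ (1/ y) ∣

bernoulli : ∀ {δ} → 0ℚ ≤ℚ δ → δ ≤ℚ 1ℚ → ∀ r → (1ℚ - δ) ^ r * (1ℚ + fromℕ r * δ) ≤ℚ 1ℚ
bernoulli {δ} 0≤δ δ≤1 zero =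
  ℚₚ.≤-reflexive (solve 1 (λ δ → con 1ℚ :* (con 1ℚ :+ con 0ℚ :* δ) := con 1ℚ) refl δ)
bernoulli {δ} 0≤δ δ≤1 (suc r) =
  ≤-byGap ((1ℚ - ρʳ * (1ℚ + fromℕ r * δ)) + ρʳ * (δ * δ) * (1ℚ + fromℕ r))
    (nonNeg+nonNeg (p≤q⇒0≤q-p (bernoulli 0≤δ δ≤1 r))
      (nonNeg*nonNeg (nonNeg*nonNeg 0≤ρʳ (nonNeg*nonNeg 0≤δ 0≤δ)) (fromℕ-nonNeg (suc r))))
    (solve 3 (λ q R d → (con 1ℚ :- q :* (con 1ℚ :+ R :* d)) :+ q :* (d :* d) :* (con 1ℚ :+ R)
                        := con 1ℚ :- (con 1ℚ :- d) :* q :* (con 1ℚ :+ (con 1ℚ :+ R) :* d))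
       refl ρʳ (fromℕ r) δ)
  where
  ρʳ = (1ℚ - δ) ^ r
  0≤ρʳ : 0ℚ ≤ℚ ρʳ
  0≤ρʳ = 0≤⇒0≤^ (p≤q⇒0≤q-p δ≤1) r

^-eventually-< : ∀ {δ ε} → 0ℚ <ℚ δ → δ ≤ℚ 1ℚ → 0ℚ <ℚ ε → ∃ λ r → (1ℚ - δ) ^ r <ℚ ε
^-eventually-< {δ} {ε} 0<δ δ≤1 0<ε = r , ℚₚ.*-cancelʳ-<-nonNeg P {{ℚ.nonNegative 0≤P}} ρʳP<εP
  where
  0<δε : 0ℚ <ℚ δ * ε
  0<δε = subst (_<ℚ δ * ε) (ℚₚ.*-zeroˡ ε) (ℚₚ.*-monoˡ-<-pos ε {{ℚ.positive 0<ε}} 0<δ)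
  r = proj₁ (archimedean 0<δε)
  P = 1ℚ + fromℕ r * δ
  0≤P : 0ℚ ≤ℚ P
  0≤P = nonNeg+nonNeg 0≤1 (nonNeg*nonNeg (fromℕ-nonNeg r) (ℚₚ.<⇒≤ 0<δ))
  ρʳP<εP : (1ℚ - δ) ^ r * P <ℚ ε * P
  ρʳP<εP = begin-strict
    (1ℚ - δ) ^ r * P   ≤⟨ bernoulli (ℚₚ.<⇒≤ 0<δ) δ≤1 r ⟩
    1ℚ                 ≤⟨ proj₂ (archimedean 0<δε) ⟩
    fromℕ r * (δ * ε)  <⟨ <-byGap ε 0<ε (solve 3 (λ ε R δ → ε := ε :* (con 1ℚ :+ R :* δ) :- R :* (δ :* ε))
                                                  refl ε (fromℕ r) δ) ⟩
    ε * P              ∎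
    where open ℚₚ.≤-Reasoning

∑ : List ℕ → (ℕ → ℚ) → ℚ
∑ ks h = sumℚ (map h ks)

1≤fromℕ-length : ∀ {ks : List ℕ} {k} → k ∈ ks → 1ℚ ≤ℚ fromℕ (length ks)
1≤fromℕ-length {_ ∷ ks} _ = 1≤fromℕ-suc (length ks)

∑-+-const : ∀ ks h c → ∑ ks (λ k → h k + c) ≡ ∑ ks h + fromℕ (length ks) * c
∑-+-const [] h c = solve 1 (λ c → con 0ℚ := con 0ℚ :+ con 0ℚ :* c) refl c
∑-+-const (k ∷ ks) h c = begin
  h k + c + ∑ ks (λ k → h k + c)               ≡⟨ cong (h k + c +_) (∑-+-const ks h c) ⟩
  h k + c + (∑ ks h + fromℕ (length ks) * c)   ≡⟨ solve 4 (λ x c y n → x :+ c :+ (y :+ n :* c)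
                                                                  := x :+ y :+ (con 1ℚ :+ n) :* c)
                                                    refl (h k) c (∑ ks h) (fromℕ (length ks)) ⟩
  h k + ∑ ks h + (1ℚ + fromℕ (length ks)) * c  ∎
  where open ≡-Reasoning

∑-neg : ∀ ks h → ∑ ks (λ k → - h k) ≡ - ∑ ks h
∑-neg [] h = refl
∑-neg (k ∷ ks) h = trans (cong (- h k +_) (∑-neg ks h)) (sym (ℚₚ.neg-distrib-+ (h k) (∑ ks h)))

∑-cong : ∀ {ks h h′} → All (λ k → h k ≡ h′ k) ks → ∑ ks h ≡ ∑ ks h′
∑-cong [] = refl
∑-cong (hk≡h′k ∷ eqs) = cong₂ _+_ hk≡h′k (∑-cong eqs)

∑-nonNeg : ∀ {ks h} → All (λ k → 0ℚ ≤ℚ h k) ks → 0ℚ ≤ℚ ∑ ks h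
∑-nonNeg [] = ℚₚ.≤-refl
∑-nonNeg (0≤hk ∷ 0≤hs) = nonNeg+nonNeg 0≤hk (∑-nonNeg 0≤hs)

term≤∑ : ∀ {ks h k} → All (λ k → 0ℚ ≤ℚ h k) ks → k ∈ ks → h k ≤ℚ ∑ ks h
term≤∑ {k ∷ ks} {h} (_ ∷ 0≤hs) (here refl) =
  ≤-byGap (∑ ks h) (∑-nonNeg 0≤hs) (solve 2 (λ x y → y := x :+ y :- x) refl (h k) (∑ ks h))
term≤∑ {k ∷ ks} {h} {k′} (0≤hk ∷ 0≤hs) (there k′∈) =
  ≤-byGap (∑ ks h - h k′ + h k) (nonNeg+nonNeg (p≤q⇒0≤q-p (term≤∑ 0≤hs k′∈)) 0≤hk)
    (solve 3 (λ y z x → y :- z :+ x := x :+ y :- z) refl (∑ ks h) (h k′) (h k))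

∑≤length : ∀ {ks h} → All (λ k → h k ≤ℚ 1ℚ) ks → ∑ ks h ≤ℚ fromℕ (length ks)
∑≤length [] = ℚₚ.≤-refl
∑≤length (hk≤1 ∷ hs≤1) = ℚₚ.+-mono-≤ hk≤1 (∑≤length hs≤1)

negOnePow-even : ∀ {k} → 2 ∣ k → negOnePow k ≡ 1ℚ
negOnePow-even {zero} _ = refl
negOnePow-even {suc zero} 2∣1 with () ← ∣1⇒≡1 2∣1
negOnePow-even {suc (suc k)} 2∣2+k =
  trans (neg-involutive (negOnePow k)) (negOnePow-even (∣m+n∣m⇒∣n {m = 2} 2∣2+k ∣-refl))

negOnePow-odd : ∀ {k} → ¬ 2 ∣ k → negOnePow k ≡ - 1ℚ
negOnePow-odd {zero} 2∤0 = ⊥-elim (2∤0 (2 ∣0))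
negOnePow-odd {suc zero} _ = refl
negOnePow-odd {suc (suc k)} 2∤2+k =
  trans (neg-involutive (negOnePow k)) (negOnePow-odd (λ 2∣k → 2∤2+k (∣m∣n⇒∣m+n ∣-refl 2∣k)))

BoundedFrom : ℕ → (ℕ → ℚ) → ℚ → Set
BoundedFrom m g M = ∀ n → m ≤ n → - M ≤ℚ g n × g n ≤ℚ M

boundedFrom-neg : ∀ {m g M} → BoundedFrom m g M → BoundedFrom m (λ n → - g n) M
boundedFrom-neg {g = g} {M} bnd n m≤n =
  ℚₚ.neg-antimono-≤ (proj₂ (bnd n m≤n)) ,
  subst (- g n ≤ℚ_) (neg-involutive M) (ℚₚ.neg-antimono-≤ (proj₁ (bnd n m≤n)))

module LinearRecurrence (ks : List ℕ) where

  K : ℕ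
  K = max 0 ks

  s : ℚ
  s = fromℕ (length ks)

  Recurrent : (ℕ → ℚ) → Set
  Recurrent g = ∀ n → K ≤ n → ∑ ks (λ j → g (n ∸ j)) ≡ - (s * g n)

  recurrent-neg : ∀ {g} → Recurrent g → Recurrent (λ n → - g n)
  recurrent-neg {g} rec n K≤n = begin
    ∑ ks (λ j → - g (n ∸ j))  ≡⟨ ∑-neg ks (λ j → g (n ∸ j)) ⟩
    - ∑ ks (λ j → g (n ∸ j))  ≡⟨ cong -_ (rec n K≤n) ⟩
    - - (s * g n)             ≡⟨ cong -_ (ℚₚ.neg-distribʳ-* s (g n)) ⟩
    - (s * - g n)             ∎
    where open ≡-Reasoning

  centred-recurrent : ∀ {f : ℕ → ℚ} {w} → w * s ≡ 1ℚ →
                      (∀ n → K ≤ n → f n ≡ 1ℚ - w * ∑ ks (λ j → f (n ∸ j))) →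
                      Recurrent (λ n → f n - ½)
  centred-recurrent {f} {w} w*s≡1 f-rec n K≤n = begin
    ∑ ks (λ j → f (n ∸ j) + - ½)  ≡⟨ ∑-+-const ks (λ j → f (n ∸ j)) (- ½) ⟩
    X + s * - ½                   ≡⟨ cong (_+ s * - ½) (sym (ℚₚ.*-identityʳ X)) ⟩
    X * 1ℚ + s * - ½              ≡⟨ cong (λ z → X * z + s * - ½) (sym w*s≡1) ⟩
    X * (w * s) + s * - ½         ≡⟨ solve 3 (λ X w s → X :* (w :* s) :+ s :* (:- con ½)
                                                       := :- (s :* (con 1ℚ :- w :* X :- con ½))) refl X w s ⟩
    - (s * (1ℚ - w * X - ½))      ≡⟨ cong (λ z → - (s * (z - ½))) (sym (f-rec n K≤n)) ⟩
    - (s * (f n - ½))             ∎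
    where
    open ≡-Reasoning
    X = ∑ ks (λ j → f (n ∸ j))

  near-top⇒near-bottom : ∀ {g m M n j e} → Recurrent g → BoundedFrom m g M → m ℕ.+ K ≤ n → j ∈ ks →
                         M - e ≤ℚ g n → M - s * e ≤ℚ - g (n ∸ j)
  near-top⇒near-bottom {g} {m} {M} {n} {j} {e} rec bnd m+K≤n j∈ near = begin
    M - s * e          ≤⟨ -‿antimonoʳ-≤ M (*-monoˡ-≤-0≤ (fromℕ-nonNeg (length ks)) gap≤e) ⟩
    M - s * (M - g n)  ≡⟨ cong (λ x → M - x) (sym ∑h≡) ⟩
    M - ∑ ks h         ≤⟨ -‿antimonoʳ-≤ M (term≤∑ 0≤h j∈) ⟩
    M - h j            ≡⟨ solve 2 (λ M x → M :- (x :+ M) := :- x) refl M (g (n ∸ j)) ⟩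
    - g (n ∸ j)        ∎
    where
    open ℚₚ.≤-Reasoning
    h : ℕ → ℚ
    h i = g (n ∸ i) + M
    m≤n∸i : ∀ {i} → i ∈ ks → m ≤ n ∸ i
    m≤n∸i i∈ = ℕₚ.≤-trans (ℕₚ.m+n≤o⇒m≤o∸n m m+K≤n) (ℕₚ.∸-monoʳ-≤ n (All.lookup (xs≤max 0 ks) i∈))
    0≤h : All (λ i → 0ℚ ≤ℚ h i) ks
    0≤h = All.tabulate λ {i} i∈ →
      ≤-byGap (g (n ∸ i) - - M) (p≤q⇒0≤q-p (proj₁ (bnd (n ∸ i) (m≤n∸i i∈))))
        (solve 2 (λ x M → x :- :- M := x :+ M :- con 0ℚ) refl (g (n ∸ i)) M)
    ∑h≡ : ∑ ks h ≡ s * (M - g n)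
    ∑h≡ = begin-equality
      ∑ ks h                          ≡⟨ ∑-+-const ks (λ i → g (n ∸ i)) M ⟩
      ∑ ks (λ i → g (n ∸ i)) + s * M  ≡⟨ cong (_+ s * M) (rec n (ℕₚ.m+n≤o⇒n≤o m m+K≤n)) ⟩
      - (s * g n) + s * M             ≡⟨ solve 3 (λ s x M → :- (s :* x) :+ s :* M := s :* (M :- x)) refl s (g n) M ⟩
      s * (M - g n)                   ∎
    gap≤e : M - g n ≤ℚ e
    gap≤e = ≤-byGap (g n - (M - e)) (p≤q⇒0≤q-p near)
      (solve 3 (λ M x e → x :- (M :- e) := e :- (M :- x)) refl M (g n) e)

  near-top⇒near-signed-top : ∀ q {g m M n j e} → Recurrent g → BoundedFrom m g M → m ℕ.+ q ℕ.* K ≤ n → j ∈ ks →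
         M - e ≤ℚ g n → M - s ^ q * e ≤ℚ negOnePow q * g (n ∸ q ℕ.* j)
  near-top⇒near-signed-top zero {g} {M = M} {n} {e = e} _ _ _ _ near =
    subst₂ (λ x y → M - x ≤ℚ y) (sym (ℚₚ.*-identityˡ e)) (sym (ℚₚ.*-identityˡ (g n))) near
  near-top⇒near-signed-top (suc q) {g} {m} {M} {n} {j} {e} rec bnd bound j∈ near =
    subst₂ (λ x y → M - x ≤ℚ y) (solve 3 (λ p s e → p :* (s :* e) := s :* p :* e) refl (s ^ q) s e) sign
      (near-top⇒near-signed-top q (recurrent-neg rec) (boundedFrom-neg bnd) bound′ j∈ first)
    where
    first : M - s * e ≤ℚ - g (n ∸ j)
    first = near-top⇒near-bottom rec bnd (ℕₚ.≤-trans (ℕₚ.+-monoʳ-≤ m (ℕₚ.m≤m+n K (q ℕ.* K))) bound) j∈ near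
    bound′ : m ℕ.+ q ℕ.* K ≤ n ∸ j
    bound′ = ℕₚ.m+n≤o⇒m≤o∸n (m ℕ.+ q ℕ.* K)
      (ℕₚ.≤-trans (ℕₚ.+-monoʳ-≤ (m ℕ.+ q ℕ.* K) (All.lookup (xs≤max 0 ks) j∈))
        (subst (ℕ._≤ n) (sym (trans (ℕₚ.+-assoc m (q ℕ.* K) K) (cong (m ℕ.+_) (ℕₚ.+-comm (q ℕ.* K) K)))) bound))
    sign : negOnePow q * - g (n ∸ j ∸ q ℕ.* j) ≡ negOnePow (suc q) * g (n ∸ suc q ℕ.* j)
    sign = trans (sym (ℚₚ.neg-distribʳ-* (negOnePow q) _))
      (trans (ℚₚ.neg-distribˡ-* (negOnePow q) _)
        (cong (λ i → - negOnePow q * g i) (ℕₚ.∸-+-assoc n j (q ℕ.* j))))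

  module Contraction {k k′} (k∈ : k ∈ ks) (k′∈ : k′ ∈ ks) (2∣k : 2 ∣ k) (2∤k′ : ¬ 2 ∣ k′) where

    C : ℚ
    C = ½ * (s ^ k + s ^ k′)

    1≤C : 1ℚ ≤ℚ C
    1≤C = ≤-byGap (½ * ((s ^ k - 1ℚ) + (s ^ k′ - 1ℚ)))
      (nonNeg*nonNeg (ℚₚ.nonNegative⁻¹ ½)
        (nonNeg+nonNeg (p≤q⇒0≤q-p (1≤⇒1≤^ 1≤s k)) (p≤q⇒0≤q-p (1≤⇒1≤^ 1≤s k′))))
      (solve 2 (λ x y → con ½ :* ((x :- con 1ℚ) :+ (y :- con 1ℚ)) := con ½ :* (x :+ y) :- con 1ℚ)
         refl (s ^ k) (s ^ k′))
      where
      1≤s : 1ℚ ≤ℚ s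
      1≤s = 1≤fromℕ-length k∈

    instance
      C-positive : ℚ.Positive C
      C-positive = ℚ.positive (ℚₚ.<-≤-trans (ℚₚ.positive⁻¹ 1ℚ) 1≤C)
      C-nonZero : ℚ.NonZero C
      C-nonZero = ℚₚ.pos⇒nonZero C

    δ : ℚ
    δ = 1/ C

    ρ : ℚ
    ρ = 1ℚ - δ

    0<δ : 0ℚ <ℚ δ
    0<δ = ℚₚ.positive⁻¹ δ {{ℚₚ.1/pos⇒pos C}}

    δ≤1 : δ ≤ℚ 1ℚ
    δ≤1 = ≤-byGap ((C - 1ℚ) * δ) (nonNeg*nonNeg (p≤q⇒0≤q-p 1≤C) (ℚₚ.<⇒≤ 0<δ))
      (trans (solve 2 (λ C d → (C :- con 1ℚ) :* d := d :* C :- d) refl C δ) (cong (_- δ) (ℚₚ.*-inverseˡ C)))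

    δ*C*p≡p : ∀ p → δ * (C * p) ≡ p
    δ*C*p≡p p = trans (sym (ℚₚ.*-assoc δ C p)) (trans (cong (_* p) (ℚₚ.*-inverseˡ C)) (ℚₚ.*-identityˡ p))

    -- k steps of the odd size k′ and k′ steps of the even size k both lead back to n ∸ k * k′, with an even
    -- and an odd number of sign changes respectively: there g is close to M and to -M at the same time.
    M≤C*gap : ∀ {g m M n} → Recurrent g → BoundedFrom m g M → K ℕ.* K ℕ.+ m ≤ n → M ≤ℚ C * (M - g n)
    M≤C*gap {g} {m} {M} {n} rec bnd bound =
      ≤-byGap (½ * ((x - (M - s ^ k * e)) + (- x - (M - s ^ k′ * e))))
        (nonNeg*nonNeg (ℚₚ.nonNegative⁻¹ ½) (nonNeg+nonNeg (p≤q⇒0≤q-p near-x) (p≤q⇒0≤q-p near-−x)))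
        (solve 5 (λ x M a b e → con ½ :* ((x :- (M :- a :* e)) :+ (:- x :- (M :- b :* e)))
                                 := con ½ :* (a :+ b) :* e :- M)
           refl x M (s ^ k) (s ^ k′) e)
      where
      e = M - g n
      x = g (n ∸ k ℕ.* k′)
      near-n : M - e ≤ℚ g n
      near-n = ℚₚ.≤-reflexive (solve 2 (λ M y → M :- (M :- y) := y) refl M (g n))
      room : ∀ {j} → j ∈ ks → m ℕ.+ j ℕ.* K ≤ n
      room j∈ = ℕₚ.≤-trans (ℕₚ.+-monoʳ-≤ m (ℕₚ.*-monoˡ-≤ K (All.lookup (xs≤max 0 ks) j∈)))
        (subst (ℕ._≤ n) (ℕₚ.+-comm (K ℕ.* K) m) bound)
      near-x : M - s ^ k * e ≤ℚ x
      near-x = subst (M - s ^ k * e ≤ℚ_) (trans (cong (_* x) (negOnePow-even 2∣k)) (ℚₚ.*-identityˡ x))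
        (near-top⇒near-signed-top k rec bnd (room k∈) k′∈ near-n)
      near-−x : M - s ^ k′ * e ≤ℚ - x
      near-−x = subst (M - s ^ k′ * e ≤ℚ_)
        (trans (cong₂ _*_ (negOnePow-odd 2∤k′) (cong (λ i → g (n ∸ i)) (ℕₚ.*-comm k′ k)))
               (solve 1 (λ y → :- con 1ℚ :* y := :- y) refl x))
        (near-top⇒near-signed-top k′ rec bnd (room k′∈) k∈ near-n)

    upper-contract : ∀ {g m M n} → Recurrent g → BoundedFrom m g M → K ℕ.* K ℕ.+ m ≤ n → g n ≤ℚ ρ * M
    upper-contract {g} {m} {M} {n} rec bnd bound = begin
      g n                      ≡⟨ solve 2 (λ M y → y := M :- (M :- y)) refl M (g n) ⟩
      M - (M - g n)            ≡⟨ cong (λ z → M - z) (sym (δ*C*p≡p (M - g n))) ⟩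
      M - δ * (C * (M - g n))  ≤⟨ -‿antimonoʳ-≤ M (*-monoˡ-≤-0≤ (ℚₚ.<⇒≤ 0<δ) (M≤C*gap rec bnd bound)) ⟩
      M - δ * M              ≡⟨ solve 2 (λ M d → M :- d :* M := (con 1ℚ :- d) :* M) refl M δ ⟩
      ρ * M                  ∎
      where open ℚₚ.≤-Reasoning

    contract : ∀ {g m M} → Recurrent g → BoundedFrom m g M → BoundedFrom (K ℕ.* K ℕ.+ m) g (ρ * M)
    contract {g} {m} {M} rec bnd n bound =
      subst (- (ρ * M) ≤ℚ_) (neg-involutive (g n))
        (ℚₚ.neg-antimono-≤ (upper-contract (recurrent-neg rec) (boundedFrom-neg bnd) bound)) ,
      upper-contract rec bnd bound

    contract-iterated : ∀ {g} → Recurrent g → BoundedFrom 0 g 1ℚ → ∀ r → BoundedFrom (r ℕ.* (K ℕ.* K)) g (ρ ^ r)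
    contract-iterated rec bnd zero = bnd
    contract-iterated {g} rec bnd (suc r) =
      contract {g} {r ℕ.* (K ℕ.* K)} {ρ ^ r} rec (contract-iterated rec bnd r)

    tendsTo0 : ∀ {g} → Recurrent g → BoundedFrom 0 g 1ℚ →
               ∀ ε → 0ℚ <ℚ ε → ∃ λ N → ∀ n → N ≤ n → ∣ g n ∣ <ℚ ε
    tendsTo0 {g} rec bnd ε 0<ε = r ℕ.* (K ℕ.* K) , λ n bound →
      -q≤p≤q<r⇒∣p∣<r {g n} {ρ ^ r} {ε} (proj₁ (contract-iterated rec bnd r n bound))
                              (proj₂ (contract-iterated rec bnd r n bound)) ρ^r<ε
      where
      eventually : ∃ λ r → ρ ^ r <ℚ ε
      eventually = ^-eventually-< {δ} {ε} 0<δ δ≤1 0<ε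
      r = proj₁ eventually
      ρ^r<ε = proj₂ eventually

IsProbability : ℚ → Set
IsProbability p = 0ℚ ≤ℚ p × p ≤ℚ 1ℚ

at-isProbability : ∀ {h} i → All IsProbability h → IsProbability (at h i)
at-isProbability i [] = ℚₚ.≤-refl , 0≤1
at-isProbability zero (p ∷ _) = p
at-isProbability (suc i) (_ ∷ ps) = at-isProbability i ps

[1+negOnePow]*½-isProbability : ∀ m → IsProbability ((1ℚ + negOnePow m) * ½)
[1+negOnePow]*½-isProbability m with 2 ∣? m
... | yes 2∣m rewrite negOnePow-even 2∣m = 0≤1 , ℚₚ.≤-refl
... | no 2∤m rewrite negOnePow-odd 2∤m = ℚₚ.≤-refl , 0≤1

1-mean-isProbability : ∀ L {X} → 0ℚ ≤ℚ X → X ≤ℚ fromℕ (suc L) → IsProbability (1ℚ - (ℤ.+ 1 ℚ./ suc L) * X)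
1-mean-isProbability L {X} 0≤X X≤N =
  ≤-byGap (w * (fromℕ (suc L) - X)) (nonNeg*nonNeg (0≤1/suc L) (p≤q⇒0≤q-p X≤N))
    (trans (solve 3 (λ w N X → w :* (N :- X) := w :* N :- w :* X) refl w (fromℕ (suc L)) X)
      (trans (cong (_- w * X) (1/suc*fromℕ-suc L))
        (solve 2 (λ w X → con 1ℚ :- w :* X := con 1ℚ :- w :* X :- con 0ℚ) refl w X))) ,
  ≤-byGap (w * X) (nonNeg*nonNeg (0≤1/suc L) 0≤X)
    (solve 2 (λ w X → w :* X := con 1ℚ :- (con 1ℚ :- w :* X)) refl w X)
  where
  w = ℤ.+ 1 ℚ./ suc L

if-preserves : ∀ {a p} {A : Set a} (P : A → Set p) b {x y} → P x → P y → P (if b then x else y)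
if-preserves P true Px _ = Px
if-preserves P false _ Py = Py

probability⇒centred-bounded : ∀ {f : ℕ → ℚ} → (∀ n → IsProbability (f n)) → BoundedFrom 0 (λ n → f n - ½) 1ℚ
probability⇒centred-bounded {f} f-prob n _ =
  ≤-byGap (f n + ½) (nonNeg+nonNeg (proj₁ (f-prob n)) (ℚₚ.nonNegative⁻¹ ½))
    (solve 1 (λ x → x :+ con ½ := x :- con ½ :- :- con 1ℚ) refl (f n)) ,
  ≤-byGap ((1ℚ - f n) + ½) (nonNeg+nonNeg (p≤q⇒0≤q-p (proj₂ (f-prob n))) (ℚₚ.nonNegative⁻¹ ½))
    (solve 1 (λ x → con 1ℚ :- x :+ con ½ := con 1ℚ :- (x :- con ½)) refl (f n))

mutual
  value-isProbability : ∀ Ts n {h} → All IsProbability h → IsProbability (value Ts n h)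
  value-isProbability [] n _ = ℚₚ.≤-refl , 0≤1
  value-isProbability (k ∷ []) n _ = [1+negOnePow]*½-isProbability (suc (divN n k))
  value-isProbability (k ∷ Ts@(_ ∷ _)) n {h} h-prob = if-preserves IsProbability (n ℕ.<ᵇ k)
    (value-isProbability Ts n (hist-isProbability Ts n))
    (1-mean-isProbability (length Ts)
      (∑-nonNeg {k ∷ Ts} {hᵢ} (All.tabulate λ {j} _ → proj₁ (at-isProbability (j ∸ 1) h-prob)))
      (∑≤length {k ∷ Ts} {hᵢ} (All.tabulate λ {j} _ → proj₂ (at-isProbability (j ∸ 1) h-prob))))
    where
    hᵢ : ℕ → ℚ
    hᵢ j = at h (j ∸ 1)

  hist-isProbability : ∀ Ts n → All IsProbability (hist Ts n)
  hist-isProbability Ts zero = []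
  hist-isProbability Ts (suc n) = value-isProbability Ts n (hist-isProbability Ts n) ∷ hist-isProbability Ts n

aᵣ : List ℕ → ℕ → ℚ
aᵣ Ts n = value Ts n (hist Ts n)

at-hist : ∀ Ts {n i} → i < n → at (hist Ts n) i ≡ aᵣ Ts (n ∸ suc i)
at-hist Ts {suc n} {zero} _ = refl
at-hist Ts {suc n} {suc i} (ℕ.s≤s i<n) = at-hist Ts i<n

aᵣ-recurrence : ∀ {k r rest n} → All (1 ≤_) (k ∷ r ∷ rest) → All (_≤ n) (k ∷ r ∷ rest) →
  aᵣ (k ∷ r ∷ rest) n
    ≡ 1ℚ - (ℤ.+ 1 ℚ./ suc (length (r ∷ rest))) * ∑ (k ∷ r ∷ rest) (λ j → aᵣ (k ∷ r ∷ rest) (n ∸ j))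
aᵣ-recurrence {k} {r} {rest} {n} 1≤Ts Ts≤n@(k≤n ∷ _) with n ℕ.<ᵇ k in n<ᵇk
... | true = ⊥-elim (ℕₚ.<⇒≱ (ℕₚ.<ᵇ⇒< n k (subst T (sym n<ᵇk) _)) k≤n)
... | false = cong (λ z → 1ℚ - (ℤ.+ 1 ℚ./ suc (length (r ∷ rest))) * z)
                   (∑-cong (All.zipWith at≡aᵣ (1≤Ts , Ts≤n)))
  where
  Ts = k ∷ r ∷ rest
  at≡aᵣ : ∀ {j} → 1 ≤ j × j ≤ n → at (hist Ts n) (j ∸ 1) ≡ aᵣ Ts (n ∸ j)
  at≡aᵣ {suc j} (_ , j<n) = at-hist Ts j<n

aᵣ-converges : ∀ Ts {k k′} → All (1 ≤_) Ts → k ∈ Ts → k′ ∈ Ts → 2 ∣ k → ¬ 2 ∣ k′ → ConvergesTo (aᵣ Ts) ½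
aᵣ-converges [] _ () _ _ _
aᵣ-converges (k ∷ []) _ (here refl) (here refl) 2∣k 2∤k = ⊥-elim (2∤k 2∣k)
aᵣ-converges Ts@(_ ∷ r ∷ rest) 1≤Ts k∈ k′∈ 2∣k 2∤k′ =
  tendsTo0 (centred-recurrent {aᵣ Ts} {w} (1/suc*fromℕ-suc (length (r ∷ rest))) recurrence)
    (probability⇒centred-bounded (λ n → value-isProbability Ts n (hist-isProbability Ts n)))
  where
  open LinearRecurrence Ts
  open Contraction k∈ k′∈ 2∣k 2∤k′
  w = ℤ.+ 1 ℚ./ suc (length (r ∷ rest))
  recurrence : ∀ n → K ≤ n → aᵣ Ts n ≡ 1ℚ - w * ∑ Ts (λ j → aᵣ Ts (n ∸ j))
  recurrence n K≤n = aᵣ-recurrence 1≤Ts (All.map (λ j≤K → ℕₚ.≤-trans j≤K K≤n) (xs≤max 0 Ts))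

∣gcdList : ∀ {d S} → All (d ∣_) S → d ∣ gcdList S
∣gcdList [] = _ ∣0
∣gcdList (d∣k ∷ d∣S) = gcd-greatest d∣k (∣gcdList d∣S)

gcdList≡1⇒¬All-even : ∀ {S} → gcdList S ≡ 1 → ¬ All (2 ∣_) S
gcdList≡1⇒¬All-even gcd≡1 all-even with () ← ∣1⇒≡1 (subst (2 ∣_) gcd≡1 (∣gcdList all-even))

mainTheorem4 : (S : List ℕ) → S ≢ [] → All (λ k → 1 ≤ k) S → Linked _<_ S →
    gcdList S ≡ 1 → Any (λ k → 2 ∣ k) S → ConvergesTo (a S) ½
mainTheorem4 S _ 1≤S _ gcd≡1 any-even
  with k , k∈ , 2∣k ← find any-even
     | k′ , k′∈ , 2∤k′ ← find (¬All⇒Any¬ (2 ∣?_) S (gcdList≡1⇒¬All-even gcd≡1)) =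
  aᵣ-converges (reverse S) (All.tabulate (λ j∈ → All.lookup 1≤S (reverse⁻ j∈)))
    (reverse⁺ k∈) (reverse⁺ k′∈) 2∣k 2∤k′
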